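{- A permutation $\pi\in B_n$ is a signed arc permutation if and only if it avoids the following $24$ patterns (each $\pm$ ranging independently over both signs): $$[\pm1,-2,\pm3],\ [\pm1,3,\pm2],\ [\pm2,-3,\pm1],\ [\pm2,1,\pm3],\ [\pm3,-1,\pm2],\ [\pm3,2,\pm1].$$
   Context: $B_n$ is the group of bijections $\pi$ of $\{\pm1,\dots,\pm n\}$ with $\pi(-a)=-\pi(a)$, written $\pi=[\pi(1),\dots,\pi(n)]$. An interval of $\mathbb{Z}_n$ is a set of the form $\{a,a+1,\dots,b\}$ or $\{b,b+1,\dots,n,1,2,\dots,a\}$ with $1\le a\le b\le n$. A permutation $\pi\in B_n$ is a signed arc permutation if for every $1<i<n$: (1) $\{|\pi(1)|,\dots,|\pi(i)|\}$ is an interval of $\mathbb{Z}_n$; and (2) $\pi(i)>0$ if $|\pi(i)|-1\in\{|\pi(1)|,\dots,|\pi(i-1)|\}$ and $\pi(i)<0$ if $|\pi(i)|+1\in\{|\pi(1)|,\dots,|\pi(i-1)|\}$, with arithmetic in $\mathbb{Z}_n$ (values in $\{1,\dots,n\}$); no restriction on the signs of $\pi(1),\pi(n)$. Pattern containment: $\pi\in B_n$ contains $\sigma\in B_k$ if there are indices $i_1<\dots<i_k$ such that $\pi(i_j)$ and $\sigma(j)$ have the same sign for all $j$ and $|\pi(i_1)|\cdots|\pi(i_k)|$ is in the same relative order as $|\sigma(1)|\cdots|\sigma(k)|$; otherwise $\pi$ avoids $\sigma$. -}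

module Defs where

open import Data.Nat using (ℕ; zero; suc; _+_)
import Data.Nat as N
open import Data.Fin using (Fin; zero; suc; toℕ; _≤_; _<_)
open import Data.Fin.Permutation using (Permutation′; permutation; _⟨$⟩ʳ_)
open import Data.Bool using (Bool; true; false)
open import Data.Product using (Σ; ∃; ∃-syntax; _×_; _,_)
open import Data.Sum using (_⊎_)
open import Function.Bundles using (_⇔_)
open import Relation.Binary.PropositionalEquality using (_≡_; refl)

-- Values {1,…,n} and positions {1,…,n} are both represented by Fin n
-- (k ↦ toℕ k + 1).  π(i) = ε_i · (abs(i) + 1) where ε_i is the sign
-- (true = positive, false = negative) and abs is a permutation of Fin n.
-- π(−a) = −π(a) then determines π on {±1,…,±n}; this is in bijection
-- with B_n.

record SignedPerm (n : ℕ) : Set where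
  constructor mkSP
  field
    sign : Fin n → Bool
    abs  : Permutation′ n

open SignedPerm public

∣_∣at_ : ∀ {n} → SignedPerm n → Fin n → Fin n
∣ π ∣at i = abs π ⟨$⟩ʳ i

Subset : ℕ → Set₁
Subset n = Fin n → Set

IsInterval : ∀ {n} → Subset n → Set
IsInterval {n} S =
  Σ (Fin n) λ a → Σ (Fin n) λ b → a ≤ b ×
    ( (∀ x → (S x ⇔ (a ≤ x × x ≤ b)))
    ⊎ (∀ x → (S x ⇔ (b ≤ x ⊎ x ≤ a))) )

IsCycPred : ∀ {n} → Fin n → Fin n → Set
IsCycPred {n} x y = (toℕ x + 1 ≡ toℕ y) ⊎ (toℕ y ≡ 0 × toℕ x + 1 ≡ n)

PrefixUpTo : ∀ {n} → SignedPerm n → Fin n → Subset n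
PrefixUpTo π i x = ∃[ j ] (j ≤ i × ∣ π ∣at j ≡ x)

PrefixBefore : ∀ {n} → SignedPerm n → Fin n → Subset n
PrefixBefore π i x = ∃[ j ] (j < i × ∣ π ∣at j ≡ x)

-- position i (0-based p = toℕ i) satisfies 1 < i < n (1-based)
Inner : ∀ {n} → Fin n → Set
Inner {n} i = 1 N.≤ toℕ i × suc (toℕ i) N.< n

IsSignedArc : ∀ {n} → SignedPerm n → Set
IsSignedArc {n} π = ∀ (i : Fin n) → Inner i →
    IsInterval (PrefixUpTo π i)
  × (∀ x → IsCycPred x (∣ π ∣at i) → PrefixBefore π i x → sign π i ≡ true)
  × (∀ x → IsCycPred (∣ π ∣at i) x → PrefixBefore π i x → sign π i ≡ false)

Contains : ∀ {n k} → SignedPerm n → SignedPerm k → Set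
Contains {n} {k} π σ =
  Σ (Fin k → Fin n) λ f →
      (∀ j j′ → j < j′ → f j < f j′)
    × (∀ j → sign π (f j) ≡ sign σ j)
    × (∀ j j′ → ((∣ π ∣at f j < ∣ π ∣at f j′) ⇔ (∣ σ ∣at j < ∣ σ ∣at j′)))

Avoids : ∀ {n k} → SignedPerm n → SignedPerm k → Set
Avoids π σ = Contains π σ → Data.Empty.⊥
  where import Data.Empty

p123 p132 p213 p231 p312 p321 : Permutation′ 3
p123 = permutation f f inv inv
  where
  f : Fin 3 → Fin 3
  f zero = zero
  f (suc zero) = suc zero
  f (suc (suc zero)) = suc (suc zero)
  inv : ∀ x → f (f x) ≡ x
  inv zero = refl
  inv (suc zero) = refl
  inv (suc (suc zero)) = refl
p132 = permutation f f inv inv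
  where
  f : Fin 3 → Fin 3
  f zero = zero
  f (suc zero) = suc (suc zero)
  f (suc (suc zero)) = suc zero
  inv : ∀ x → f (f x) ≡ x
  inv zero = refl
  inv (suc zero) = refl
  inv (suc (suc zero)) = refl
p213 = permutation f f inv inv
  where
  f : Fin 3 → Fin 3
  f zero = suc zero
  f (suc zero) = zero
  f (suc (suc zero)) = suc (suc zero)
  inv : ∀ x → f (f x) ≡ x
  inv zero = refl
  inv (suc zero) = refl
  inv (suc (suc zero)) = refl
p321 = permutation f f inv inv
  where
  f : Fin 3 → Fin 3
  f zero = suc (suc zero)
  f (suc zero) = suc zero
  f (suc (suc zero)) = zero
  inv : ∀ x → f (f x) ≡ x
  inv zero = refl
  inv (suc zero) = refl
  inv (suc (suc zero)) = refl
p231 = permutation f g inv₁ inv₂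
  where
  f g : Fin 3 → Fin 3
  f zero = suc zero
  f (suc zero) = suc (suc zero)
  f (suc (suc zero)) = zero
  g zero = suc (suc zero)
  g (suc zero) = zero
  g (suc (suc zero)) = suc zero
  inv₁ : ∀ x → f (g x) ≡ x
  inv₁ zero = refl
  inv₁ (suc zero) = refl
  inv₁ (suc (suc zero)) = refl
  inv₂ : ∀ x → g (f x) ≡ x
  inv₂ zero = refl
  inv₂ (suc zero) = refl
  inv₂ (suc (suc zero)) = refl
p312 = permutation f g inv₁ inv₂
  where
  f g : Fin 3 → Fin 3
  f zero = suc (suc zero)
  f (suc zero) = zero
  f (suc (suc zero)) = suc zero
  g zero = suc zero
  g (suc zero) = suc (suc zero)
  g (suc (suc zero)) = zero
  inv₁ : ∀ x → f (g x) ≡ x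
  inv₁ zero = refl
  inv₁ (suc zero) = refl
  inv₁ (suc (suc zero)) = refl
  inv₂ : ∀ x → g (f x) ≡ x
  inv₂ zero = refl
  inv₂ (suc zero) = refl
  inv₂ (suc (suc zero)) = refl

pat : Bool → Bool → Bool → Permutation′ 3 → SignedPerm 3
pat s₁ s₂ s₃ p = mkSP sg p
  where
  sg : Fin 3 → Bool
  sg zero = s₁
  sg (suc zero) = s₂
  sg (suc (suc zero)) = s₃

data Forbidden : SignedPerm 3 → Set where
  f1 : ∀ s₁ s₃ → Forbidden (pat s₁ false s₃ p123)
  f2 : ∀ s₁ s₃ → Forbidden (pat s₁ true  s₃ p132)
  f3 : ∀ s₁ s₃ → Forbidden (pat s₁ false s₃ p231)
  f4 : ∀ s₁ s₃ → Forbidden (pat s₁ true  s₃ p213)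
  f5 : ∀ s₁ s₃ → Forbidden (pat s₁ false s₃ p312)
  f6 : ∀ s₁ s₃ → Forbidden (pat s₁ true  s₃ p321)

module Submission where

-- Both sides are shown equivalent to one intermediate property, NoBadTriple:
-- for all positions p < j < q, if π(j) is negative the values
-- |π(p)|, |π(j)|, |π(q)| must not go cyclically upward around Z_n, and if
-- π(j) is positive they must not go cyclically downward.
--
--  * The forbidden patterns are precisely the six ways three values can go
--    cyclically up (middle sign −) or down (middle sign +), so avoiding them
--    is a direct restatement of NoBadTriple (avoids⇔noBadTriple).
--  * A signed arc permutation has no bad triple: at an inner position j the
--    sign condition forces |π(j)| to be an end point of the interval
--    {|π(1)|,…,|π(j)|}, and from an end point of an interval one cannot
--    reach an inside point before an outside one (interval-start/-end).
--  * Conversely, without bad triples every new value is adjacent in Z_n to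
--    an earlier one, so prefixes grow as intervals (interval-grow), and a
--    wrong sign would again produce a bad triple (arc⇔noBadTriple).

open import Defs
open import Data.Nat using (ℕ)
open import Data.Fin.Permutation using (Permutation′)
open import Function.Bundles using (_⇔_)

open import Data.Nat using (zero; suc; _+_; _≤_; _<_; z≤n; s≤s; z<s; s<s; _≤?_; _<?_)
open import Data.Nat.Properties
open import Data.Fin as Fin using (Fin; zero; suc; toℕ; fromℕ; fromℕ<; inject₁)
open import Data.Fin.Properties using (toℕ-injective; toℕ<n; toℕ-fromℕ<; toℕ-fromℕ; toℕ-inject₁)
open import Data.Fin.Permutation using (_⟨$⟩ʳ_; _⟨$⟩ˡ_; inverseˡ; inverseʳ)
open import Data.Bool using (Bool; true; false)
open import Data.Bool.Properties using (¬-not; not-¬)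
open import Data.Product using (Σ; _×_; _,_; proj₁; proj₂)
open import Data.Sum using (_⊎_; inj₁; inj₂; [_,_])
open import Data.Sum.Function.Propositional using (_⊎-⇔_)
open import Data.Empty using (⊥; ⊥-elim)
open import Relation.Nullary using (¬_; yes; no)
open import Relation.Binary.PropositionalEquality
  using (_≡_; _≢_; refl; sym; trans; cong; subst; subst₂; ≢-sym)
open import Relation.Binary using (tri<; tri≈; tri>)
open import Function using (_∘_; id)
open import Function.Bundles using (Equivalence; mk⇔)
import Function.Properties.Equivalence as ⇔

open Equivalence using (to; from)

private
  variable
    n a b p v u w s z : ℕ

-- Cyclic order on {0,…,n−1}

CyclicOrder : ℕ → ℕ → ℕ → Set
CyclicOrder x y z = (x < y × y < z) ⊎ (y < z × z < x) ⊎ (z < x × x < y)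

rotate : ∀ {x y z} → CyclicOrder x y z → CyclicOrder y z x
rotate (inj₁ o)        = inj₂ (inj₂ o)
rotate (inj₂ (inj₁ o)) = inj₁ o
rotate (inj₂ (inj₂ o)) = inj₂ (inj₁ o)

CycSucc : ℕ → ℕ → ℕ → Set
CycSucc n p v = suc p ≡ v ⊎ (v ≡ 0 × suc p ≡ n)

isCycPred⇒CycSucc : ∀ {n} {x y : Fin n} → IsCycPred x y → CycSucc n (toℕ x) (toℕ y)
isCycPred⇒CycSucc {x = x} (inj₁ e)         = inj₁ (trans (+-comm 1 (toℕ x)) e)
isCycPred⇒CycSucc {x = x} (inj₂ (e₁ , e₂)) = inj₂ (e₁ , trans (+-comm 1 (toℕ x)) e₂)

cycSucc-≢ : CycSucc n p v → 1 < n → p ≢ v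
cycSucc-≢ (inj₁ refl)          _   e = <-irrefl e (n<1+n _)
cycSucc-≢ (inj₂ (refl , refl)) 1<n e = <⇒≱ 1<n (≤-reflexive (cong suc e))

cycSucc-cyclic : CycSucc n p v → z < n → z ≢ p → z ≢ v → CyclicOrder p v z
cycSucc-cyclic {p = p} {z = z} (inj₁ refl) _ z≢p z≢v with <-cmp z p
... | tri< z<p _ _ = inj₂ (inj₂ (z<p , ≤-refl))
... | tri≈ _ z≡p _ = ⊥-elim (z≢p z≡p)
... | tri> _ _ p<z = inj₁ (≤-refl , ≤∧≢⇒< p<z (≢-sym z≢v))
cycSucc-cyclic (inj₂ (refl , refl)) z<n z≢p z≢v =
  inj₂ (inj₁ (n≢0⇒n>0 z≢v , ≤∧≢⇒< (m<1+n⇒m≤n z<n) z≢p))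

cycSucc-cyclicʳ : CycSucc n v s → u < n → u ≢ v → u ≢ s → CyclicOrder u v s
cycSucc-cyclicʳ vs u<n u≢v u≢s = rotate (rotate (cycSucc-cyclic vs u<n u≢v u≢s))

-- The two shapes of intervals of Z_n, on numbers

InRange : ℕ → ℕ → ℕ → Set
InRange a b x = a ≤ x × x ≤ b

InWrap : ℕ → ℕ → ℕ → Set
InWrap a b x = b ≤ x ⊎ x ≤ a

range-lowerEnd : CycSucc n p v → ¬ InRange a b p → InRange a b v → v ≤ a
range-lowerEnd (inj₂ (refl , _)) _ _ = z≤n
range-lowerEnd {p = p} {a = a} (inj₁ refl) p∉ (_ , v≤b) with a ≤? p
... | yes a≤p = ⊥-elim (p∉ (a≤p , <⇒≤ v≤b))
... | no  a≰p = ≰⇒> a≰p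

range-upperEnd : b < n → CycSucc n v s → ¬ InRange a b s → InRange a b v → b ≤ v
range-upperEnd b<n (inj₂ (refl , refl)) _ _ = m<1+n⇒m≤n b<n
range-upperEnd {b = b} {v = v} _ (inj₁ refl) s∉ (a≤v , _) with suc v ≤? b
... | yes s≤b = ⊥-elim (s∉ (≤-trans a≤v (n≤1+n v) , s≤b))
... | no  s≰b = m<1+n⇒m≤n (≰⇒> s≰b)

range-start : CycSucc n p v → ¬ InRange a b p → InRange a b v →
              InRange a b u → ¬ InRange a b w → ¬ CyclicOrder u v w
range-start {v = v} {u = u} {w = w} pv p∉ v∈@(a≤v , _) (a≤u , u≤b) w∉ = past
  where
  v≤u : v ≤ u
  v≤u = ≤-trans (range-lowerEnd pv p∉ v∈) a≤u
  past : ¬ CyclicOrder u v w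
  past (inj₁ (u<v , _))          = <⇒≱ u<v v≤u
  past (inj₂ (inj₁ (v<w , w<u))) = w∉ (≤-trans a≤v (<⇒≤ v<w) , <⇒≤ (<-≤-trans w<u u≤b))
  past (inj₂ (inj₂ (_ , u<v)))   = <⇒≱ u<v v≤u

range-end : b < n → CycSucc n v s → ¬ InRange a b s → InRange a b v →
            InRange a b u → ¬ InRange a b w → ¬ CyclicOrder w v u
range-end {v = v} {u = u} {w = w} b<n vs s∉ v∈@(_ , v≤b) (a≤u , u≤b) w∉ = past
  where
  u≤v : u ≤ v
  u≤v = ≤-trans u≤b (range-upperEnd b<n vs s∉ v∈)
  past : ¬ CyclicOrder w v u
  past (inj₁ (_ , v<u))          = <⇒≱ v<u u≤v
  past (inj₂ (inj₁ (v<u , _)))   = <⇒≱ v<u u≤v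
  past (inj₂ (inj₂ (u<w , w<v))) = w∉ (≤-trans a≤u (<⇒≤ u<w) , ≤-trans (<⇒≤ w<v) v≤b)

wrap-start : b < n → CycSucc n p v → ¬ InWrap a b p → InWrap a b v →
             InWrap a b u → ¬ InWrap a b w → ¬ CyclicOrder u v w
wrap-start b<n (inj₂ (refl , refl)) p∉ _ _ _ _ = p∉ (inj₁ (m<1+n⇒m≤n b<n))
wrap-start {b = b} {p = p} {a = a} {u = u} {w = w} _ (inj₁ refl) p∉ v∈ u∈ w∉ = past
  where
  p<b : p < b
  p<b = ≰⇒> (p∉ ∘ inj₁)
  w<b : w < b
  w<b = ≰⇒> (w∉ ∘ inj₁)
  a<w : a < w
  a<w = ≰⇒> (w∉ ∘ inj₂)
  b≤v : b ≤ suc p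
  b≤v = [ id , (λ v≤a → ⊥-elim (<-asym (≰⇒> (p∉ ∘ inj₂)) v≤a)) ] v∈
  past : ¬ CyclicOrder u (suc p) w
  past (inj₁ (_ , v<w))          = <⇒≱ v<w (≤-trans (<⇒≤ w<b) b≤v)
  past (inj₂ (inj₁ (v<w , _)))   = <⇒≱ v<w (≤-trans (<⇒≤ w<b) b≤v)
  past (inj₂ (inj₂ (w<u , u<v))) =
    [ (λ b≤u → <⇒≱ u<v (≤-trans p<b b≤u)) , (λ u≤a → <⇒≱ a<w (≤-trans (<⇒≤ w<u) u≤a)) ] u∈

wrap-end : CycSucc n v s → ¬ InWrap a b s → InWrap a b v →
           InWrap a b u → ¬ InWrap a b w → ¬ CyclicOrder w v u
wrap-end (inj₂ (refl , _)) s∉ _ _ _ _ = s∉ (inj₂ z≤n)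
wrap-end {v = v} {a = a} {b = b} {u = u} {w = w} (inj₁ refl) s∉ v∈ u∈ w∉ = past
  where
  w<b : w < b
  w<b = ≰⇒> (w∉ ∘ inj₁)
  a<w : a < w
  a<w = ≰⇒> (w∉ ∘ inj₂)
  a≤v : a ≤ v
  a≤v = m<1+n⇒m≤n (≰⇒> (s∉ ∘ inj₂))
  v≤a : v ≤ a
  v≤a = [ (λ b≤v → ⊥-elim (<⇒≱ (≰⇒> (s∉ ∘ inj₁)) (≤-trans b≤v (n≤1+n v)))) , id ] v∈
  past : ¬ CyclicOrder w v u
  past (inj₁ (w<v , _))          = <⇒≱ a<w (≤-trans (<⇒≤ w<v) v≤a)
  past (inj₂ (inj₁ (v<u , u<w))) =
    [ (λ b≤u → <⇒≱ w<b (≤-trans b≤u (<⇒≤ u<w))) , (λ u≤a → <⇒≱ v<u (≤-trans u≤a a≤v)) ] u∈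
  past (inj₂ (inj₂ (_ , w<v)))   = <⇒≱ a<w (≤-trans (<⇒≤ w<v) v≤a)

Extends : ℕ → (ℕ → Set) → ℕ → (ℕ → Set) → Set
Extends n I v J = ∀ {x} → x < n → J x ⇔ (I x ⊎ v ≡ x)

range-growUp : suc p ≡ v → InRange a b p → ¬ InRange a b v →
               a ≤ v × Extends n (InRange a b) v (InRange a v)
range-growUp {p = p} {a = a} {b = b} refl (a≤p , p≤b) v∉ = a≤v , λ _ → mk⇔ shrink grow
  where
  a≤v : a ≤ suc p
  a≤v = ≤-trans a≤p (n≤1+n p)
  b≤v : b ≤ suc p
  b≤v = <⇒≤ (≰⇒> (λ v≤b → v∉ (a≤v , v≤b)))
  grow : ∀ {x} → InRange a b x ⊎ suc p ≡ x → InRange a (suc p) x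
  grow (inj₁ (a≤x , x≤b)) = a≤x , ≤-trans x≤b b≤v
  grow (inj₂ refl)        = a≤v , ≤-refl
  shrink : ∀ {x} → InRange a (suc p) x → InRange a b x ⊎ suc p ≡ x
  shrink (a≤x , x≤v) with m≤n⇒m<n∨m≡n x≤v
  ... | inj₁ x<v = inj₁ (a≤x , ≤-trans (m<1+n⇒m≤n x<v) p≤b)
  ... | inj₂ x≡v = inj₂ (sym x≡v)

range-growWrapUp : v ≡ 0 → suc p ≡ n → InRange a b p →
                   v ≤ a × Extends n (InRange a b) v (InWrap v a)
range-growWrapUp {p = p} {a = a} {b = b} refl refl (_ , p≤b) = z≤n , λ x<n → mk⇔ (shrink x<n) grow
  where
  grow : ∀ {x} → InRange a b x ⊎ 0 ≡ x → InWrap 0 a x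
  grow (inj₁ (a≤x , _)) = inj₁ a≤x
  grow (inj₂ refl)      = inj₂ z≤n
  shrink : ∀ {x} → x < suc p → InWrap 0 a x → InRange a b x ⊎ 0 ≡ x
  shrink x<n (inj₁ a≤x) = inj₁ (a≤x , ≤-trans (m<1+n⇒m≤n x<n) p≤b)
  shrink _   (inj₂ x≤0) = inj₂ (sym (n≤0⇒n≡0 x≤0))

range-growDown : suc v ≡ s → InRange a b s → ¬ InRange a b v →
                 v ≤ b × Extends n (InRange a b) v (InRange v b)
range-growDown {v = v} {a = a} {b = b} refl (a≤s , s≤b) v∉ = v≤b , λ _ → mk⇔ shrink grow
  where
  v≤b : v ≤ b
  v≤b = <⇒≤ s≤b
  v<a : v < a
  v<a = ≰⇒> (λ a≤v → v∉ (a≤v , v≤b))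
  grow : ∀ {x} → InRange a b x ⊎ v ≡ x → InRange v b x
  grow (inj₁ (a≤x , x≤b)) = ≤-trans (<⇒≤ v<a) a≤x , x≤b
  grow (inj₂ refl)        = ≤-refl , v≤b
  shrink : ∀ {x} → InRange v b x → InRange a b x ⊎ v ≡ x
  shrink (v≤x , x≤b) with m≤n⇒m<n∨m≡n v≤x
  ... | inj₁ v<x = inj₁ (≤-trans a≤s v<x , x≤b)
  ... | inj₂ v≡x = inj₂ v≡x

range-growWrapDown : s ≡ 0 → suc v ≡ n → InRange a b s → ¬ InRange a b v →
                     b ≤ v × Extends n (InRange a b) v (InWrap b v)
range-growWrapDown {v = v} {a = a} {b = b} refl refl (a≤0 , _) v∉ = b≤v , λ x<n → mk⇔ (shrink x<n) grow
  where
  a≤ : ∀ {y} → a ≤ y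
  a≤ = ≤-trans a≤0 z≤n
  b≤v : b ≤ v
  b≤v = <⇒≤ (≰⇒> (λ v≤b → v∉ (a≤ , v≤b)))
  grow : ∀ {x} → InRange a b x ⊎ v ≡ x → InWrap b v x
  grow (inj₁ (_ , x≤b)) = inj₂ x≤b
  grow (inj₂ refl)      = inj₁ ≤-refl
  shrink : ∀ {x} → x < suc v → InWrap b v x → InRange a b x ⊎ v ≡ x
  shrink x<n (inj₁ v≤x) = inj₂ (≤-antisym v≤x (m<1+n⇒m≤n x<n))
  shrink _   (inj₂ x≤b) = inj₁ (a≤ , x≤b)

wrap-growUp : suc p ≡ v → InWrap a b p → ¬ InWrap a b v →
              v ≤ b × Extends n (InWrap a b) v (InWrap v b)
wrap-growUp {p = p} {a = a} {b = b} refl p∈ v∉ = <⇒≤ v<b , λ _ → mk⇔ shrink grow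
  where
  v<b : suc p < b
  v<b = ≰⇒> (v∉ ∘ inj₁)
  a<v : a < suc p
  a<v = ≰⇒> (v∉ ∘ inj₂)
  p≤a : p ≤ a
  p≤a = [ (λ b≤p → ⊥-elim (<⇒≱ v<b (≤-trans b≤p (n≤1+n p)))) , id ] p∈
  grow : ∀ {x} → InWrap a b x ⊎ suc p ≡ x → InWrap (suc p) b x
  grow (inj₁ (inj₁ b≤x)) = inj₁ b≤x
  grow (inj₁ (inj₂ x≤a)) = inj₂ (≤-trans x≤a (<⇒≤ a<v))
  grow (inj₂ refl)       = inj₂ ≤-refl
  shrink : ∀ {x} → InWrap (suc p) b x → InWrap a b x ⊎ suc p ≡ x
  shrink (inj₁ b≤x) = inj₁ (inj₁ b≤x)
  shrink (inj₂ x≤v) with m≤n⇒m<n∨m≡n x≤v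
  ... | inj₁ x<v = inj₁ (inj₂ (≤-trans (m<1+n⇒m≤n x<v) p≤a))
  ... | inj₂ x≡v = inj₂ (sym x≡v)

wrap-growDown : suc v ≡ s → InWrap a b s → ¬ InWrap a b v →
                a ≤ v × Extends n (InWrap a b) v (InWrap a v)
wrap-growDown {v = v} {a = a} {b = b} refl s∈ v∉ = <⇒≤ a<v , λ _ → mk⇔ shrink grow
  where
  v<b : v < b
  v<b = ≰⇒> (v∉ ∘ inj₁)
  a<v : a < v
  a<v = ≰⇒> (v∉ ∘ inj₂)
  b≤s : b ≤ suc v
  b≤s = [ id , (λ s≤a → ⊥-elim (<-asym a<v s≤a)) ] s∈
  grow : ∀ {x} → InWrap a b x ⊎ v ≡ x → InWrap a v x
  grow (inj₁ (inj₁ b≤x)) = inj₁ (≤-trans (<⇒≤ v<b) b≤x)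
  grow (inj₁ (inj₂ x≤a)) = inj₂ x≤a
  grow (inj₂ refl)       = inj₁ ≤-refl
  shrink : ∀ {x} → InWrap a v x → InWrap a b x ⊎ v ≡ x
  shrink (inj₁ v≤x) with m≤n⇒m<n∨m≡n v≤x
  ... | inj₁ v<x = inj₁ (inj₁ (≤-trans b≤s v<x))
  ... | inj₂ v≡x = inj₂ v≡x
  shrink (inj₂ x≤a) = inj₁ (inj₂ x≤a)

-- Intervals of Z_n as subsets of Fin n

cycPred : ∀ {n} (y : Fin n) → Σ (Fin n) (λ x → IsCycPred x y)
cycPred {suc m} zero    = fromℕ m , inj₂ (refl , trans (cong (_+ 1) (toℕ-fromℕ m)) (+-comm m 1))
cycPred {suc m} (suc y) = inject₁ y , inj₁ (trans (cong (_+ 1) (toℕ-inject₁ y)) (+-comm (toℕ y) 1))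

cycSucc : ∀ {n} (x : Fin n) → Σ (Fin n) (λ y → IsCycPred x y)
cycSucc {suc m} x with suc (toℕ x) <? suc m
... | yes x+1<n = fromℕ< x+1<n , inj₁ (trans (+-comm (toℕ x) 1) (sym (toℕ-fromℕ< x+1<n)))
... | no  x+1≮n = zero , inj₂ (refl , trans (+-comm (toℕ x) 1) (≤-antisym (toℕ<n x) (≮⇒≥ x+1≮n)))

interval-start : ∀ {n} {S : Subset n} {x y u w : Fin n} → IsInterval S → IsCycPred x y →
                 ¬ S x → S y → S u → ¬ S w → ¬ CyclicOrder (toℕ u) (toℕ y) (toℕ w)
interval-start (_ , b , _ , inj₁ R) xy x∉ y∈ u∈ w∉ =
  range-start (isCycPred⇒CycSucc xy) (x∉ ∘ from (R _)) (to (R _) y∈) (to (R _) u∈) (w∉ ∘ from (R _))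
interval-start (_ , b , _ , inj₂ W) xy x∉ y∈ u∈ w∉ =
  wrap-start (toℕ<n b) (isCycPred⇒CycSucc xy) (x∉ ∘ from (W _)) (to (W _) y∈) (to (W _) u∈) (w∉ ∘ from (W _))

interval-end : ∀ {n} {S : Subset n} {x y u w : Fin n} → IsInterval S → IsCycPred y x →
               ¬ S x → S y → S u → ¬ S w → ¬ CyclicOrder (toℕ w) (toℕ y) (toℕ u)
interval-end (_ , b , _ , inj₁ R) yx x∉ y∈ u∈ w∉ =
  range-end (toℕ<n b) (isCycPred⇒CycSucc yx) (x∉ ∘ from (R _)) (to (R _) y∈) (to (R _) u∈) (w∉ ∘ from (R _))
interval-end (_ , b , _ , inj₂ W) yx x∉ y∈ u∈ w∉ =
  wrap-end (isCycPred⇒CycSucc yx) (x∉ ∘ from (W _)) (to (W _) y∈) (to (W _) u∈) (w∉ ∘ from (W _))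

Adjacent : ∀ {n} → Subset n → Fin n → Set
Adjacent {n} S y = Σ (Fin n) (λ x → S x × IsCycPred x y) ⊎ Σ (Fin n) (λ x → S x × IsCycPred y x)

extend : ∀ {n} {S S′ : Subset n} {y : Fin n} {I J : ℕ → Set} →
         (∀ x → S′ x ⇔ (S x ⊎ y ≡ x)) → (∀ x → S x ⇔ I (toℕ x)) →
         Extends n I (toℕ y) J → ∀ x → S′ x ⇔ J (toℕ x)
extend S′≡ S≡I ext x =
  ⇔.trans (S′≡ x) (⇔.trans (S≡I x ⊎-⇔ mk⇔ (cong toℕ) toℕ-injective) (⇔.sym (ext (toℕ<n x))))

interval-grow : ∀ {n} {S S′ : Subset n} (y : Fin n) → (∀ x → S′ x ⇔ (S x ⊎ y ≡ x)) →
                IsInterval S → ¬ S y → Adjacent S y → IsInterval S′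
interval-grow y S′≡ (a , b , _ , inj₁ R) y∉ (inj₁ (x , x∈ , xy)) with isCycPred⇒CycSucc xy
... | inj₁ e =
  let (a≤y , ext) = range-growUp e (to (R x) x∈) (y∉ ∘ from (R y))
  in a , y , a≤y , inj₁ (extend S′≡ R ext)
... | inj₂ (y≡0 , x+1≡n) =
  let (y≤a , ext) = range-growWrapUp y≡0 x+1≡n (to (R x) x∈)
  in y , a , y≤a , inj₂ (extend S′≡ R ext)
interval-grow y S′≡ (a , b , _ , inj₁ R) y∉ (inj₂ (x , x∈ , yx)) with isCycPred⇒CycSucc yx
... | inj₁ e =
  let (y≤b , ext) = range-growDown e (to (R x) x∈) (y∉ ∘ from (R y))
  in y , b , y≤b , inj₁ (extend S′≡ R ext)
... | inj₂ (x≡0 , y+1≡n) =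
  let (b≤y , ext) = range-growWrapDown x≡0 y+1≡n (to (R x) x∈) (y∉ ∘ from (R y))
  in b , y , b≤y , inj₂ (extend S′≡ R ext)
interval-grow y S′≡ (a , b , _ , inj₂ W) y∉ (inj₁ (x , x∈ , xy)) with isCycPred⇒CycSucc xy
... | inj₁ e =
  let (y≤b , ext) = wrap-growUp e (to (W x) x∈) (y∉ ∘ from (W y))
  in y , b , y≤b , inj₂ (extend S′≡ W ext)
... | inj₂ (y≡0 , _) = ⊥-elim (y∉ (from (W y) (inj₂ (≤-trans (≤-reflexive y≡0) z≤n))))
interval-grow y S′≡ (a , b , _ , inj₂ W) y∉ (inj₂ (x , x∈ , yx)) with isCycPred⇒CycSucc yx
... | inj₁ e =
  let (a≤y , ext) = wrap-growDown e (to (W x) x∈) (y∉ ∘ from (W y))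
  in a , y , a≤y , inj₂ (extend S′≡ W ext)
... | inj₂ (_ , y+1≡n) = ⊥-elim (y∉ (from (W y) (inj₁ (m<1+n⇒m≤n (subst (toℕ b <_) (sym y+1≡n) (toℕ<n b))))))

-- Patterns of length three

i₀ i₁ i₂ : Fin 3
i₀ = zero
i₁ = suc zero
i₂ = suc (suc zero)

triple : ∀ {A : Set} → A → A → A → Fin 3 → A
triple x y z zero             = x
triple x y z (suc zero)       = y
triple x y z (suc (suc zero)) = z

increasing3 : (h : Fin 3 → ℕ) → h i₀ < h i₁ → h i₁ < h i₂ → ∀ {i j} → i Fin.< j → h i < h j
increasing3 h h₀₁ h₁₂ {zero}           {suc zero}       _ = h₀₁
increasing3 h h₀₁ h₁₂ {zero}           {suc (suc zero)} _ = <-trans h₀₁ h₁₂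
increasing3 h h₀₁ h₁₂ {suc zero}       {suc (suc zero)} _ = h₁₂
increasing3 h h₀₁ h₁₂ {suc zero}       {suc zero}       (s<s ())
increasing3 h h₀₁ h₁₂ {suc (suc zero)} {suc zero}       (s<s ())
increasing3 h h₀₁ h₁₂ {suc (suc zero)} {suc (suc zero)} (s<s (s<s ()))

reflects : ∀ {A : Set} (r g : A → ℕ) → (∀ {i j} → r i < r j → g i < g j) →
           (∀ {i j} → r i ≡ r j → i ≡ j) → ∀ {i j} → g i < g j → r i < r j
reflects r g preserves injective {i} {j} gi<gj with <-cmp (r i) (r j)
... | tri< ri<rj _ _ = ri<rj
... | tri≈ _ ri≡rj _ = ⊥-elim (<-irrefl (cong g (injective ri≡rj)) gi<gj)
... | tri> _ _ rj<ri = ⊥-elim (<-asym gi<gj (preserves rj<ri))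

permutation-injective : ∀ {m} (ρ : Permutation′ m) {i j} → ρ ⟨$⟩ʳ i ≡ ρ ⟨$⟩ʳ j → i ≡ j
permutation-injective ρ e =
  trans (sym (inverseˡ ρ)) (trans (cong (ρ ⟨$⟩ˡ_) e) (inverseˡ ρ))

BadTurn : Bool → ℕ → ℕ → ℕ → Set
BadTurn false u v w = CyclicOrder u v w
BadTurn true  u v w = CyclicOrder w v u

module _ {n : ℕ} (π : SignedPerm n) where

  val : Fin n → ℕ
  val i = toℕ (∣ π ∣at i)

  val-injective : ∀ {i j} → val i ≡ val j → i ≡ j
  val-injective = permutation-injective (abs π) ∘ toℕ-injective

  val-≢ : ∀ {i j} → i Fin.< j → val i ≢ val j
  val-≢ i<j e = <-irrefl (cong toℕ (val-injective e)) i<j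

  position : Fin n → Fin n
  position x = abs π ⟨$⟩ˡ x

  at-position : ∀ x → ∣ π ∣at position x ≡ x
  at-position x = inverseʳ (abs π)

  NoBadTriple : Set
  NoBadTriple = ∀ {p j q} → p Fin.< j → j Fin.< q → ¬ BadTurn (sign π j) (val p) (val j) (val q)

  occurrence : (ρ : Permutation′ 3) {p j q : Fin n} (s₂ : Bool) → p Fin.< j → j Fin.< q → sign π j ≡ s₂ →
    val (triple p j q (ρ ⟨$⟩ˡ i₀)) < val (triple p j q (ρ ⟨$⟩ˡ i₁)) →
    val (triple p j q (ρ ⟨$⟩ˡ i₁)) < val (triple p j q (ρ ⟨$⟩ˡ i₂)) →
    Contains π (pat (sign π p) s₂ (sign π q) ρ)
  occurrence ρ {p} {j} {q} s₂ p<j j<q j≡s₂ h₀₁ h₁₂ = pick , positions , signs , values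
    where
    pick : Fin 3 → Fin n
    pick = triple p j q
    positions : ∀ i k → i Fin.< k → pick i Fin.< pick k
    positions i k = increasing3 (toℕ ∘ pick) p<j j<q
    signs : ∀ i → sign π (pick i) ≡ sign (pat (sign π p) s₂ (sign π q) ρ) i
    signs zero             = refl
    signs (suc zero)       = j≡s₂
    signs (suc (suc zero)) = refl
    rank : Fin 3 → ℕ
    rank i = toℕ (ρ ⟨$⟩ʳ i)
    preserves : ∀ {i k} → rank i < rank k → val (pick i) < val (pick k)
    preserves r = subst₂ (λ i k → val (pick i) < val (pick k)) (inverseˡ ρ) (inverseˡ ρ)
                    (increasing3 (λ i → val (pick (ρ ⟨$⟩ˡ i))) h₀₁ h₁₂ r)
    values : ∀ i k → (val (pick i) < val (pick k)) ⇔ (rank i < rank k)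
    values i k = mk⇔ (reflects rank (val ∘ pick) preserves (permutation-injective ρ ∘ toℕ-injective)) preserves

  noBadTriple⇒avoids : NoBadTriple → ∀ {σ} → Forbidden σ → Avoids π σ
  noBadTriple⇒avoids noBad {σ} forbidden (f , increasing , signs , values) = noBad
    (increasing i₀ i₁ z<s) (increasing i₁ i₂ (s<s z<s))
    (subst (λ s → BadTurn s (val (f i₀)) (val (f i₁)) (val (f i₂))) (sym (signs i₁)) (turn forbidden))
    where
    ordered : ∀ i k → ∣ σ ∣at i Fin.< ∣ σ ∣at k → val (f i) < val (f k)
    ordered i k = from (values i k)
    turn : Forbidden σ → BadTurn (sign σ i₁) (val (f i₀)) (val (f i₁)) (val (f i₂))
    turn (f1 _ _) = inj₁ (ordered i₀ i₁ z<s , ordered i₁ i₂ (s<s z<s))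
    turn (f2 _ _) = inj₂ (inj₂ (ordered i₀ i₂ z<s , ordered i₂ i₁ (s<s z<s)))
    turn (f3 _ _) = inj₂ (inj₂ (ordered i₂ i₀ z<s , ordered i₀ i₁ (s<s z<s)))
    turn (f4 _ _) = inj₂ (inj₁ (ordered i₁ i₀ z<s , ordered i₀ i₂ (s<s z<s)))
    turn (f5 _ _) = inj₂ (inj₁ (ordered i₁ i₂ z<s , ordered i₂ i₀ (s<s z<s)))
    turn (f6 _ _) = inj₁ (ordered i₂ i₁ z<s , ordered i₁ i₀ (s<s z<s))

  avoids⇒noBadTriple : (∀ σ → Forbidden σ → Avoids π σ) → NoBadTriple
  avoids⇒noBadTriple avoids {p} {j} {q} p<j j<q = refute (sign π j) refl
    where
    refute : (s : Bool) → sign π j ≡ s → ¬ BadTurn s (val p) (val j) (val q)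
    refute false j≡s (inj₁ (u<v , v<w)) =
      avoids _ (f1 _ _) (occurrence p123 false p<j j<q j≡s u<v v<w)
    refute false j≡s (inj₂ (inj₁ (v<w , w<u))) =
      avoids _ (f5 _ _) (occurrence p312 false p<j j<q j≡s v<w w<u)
    refute false j≡s (inj₂ (inj₂ (w<u , u<v))) =
      avoids _ (f3 _ _) (occurrence p231 false p<j j<q j≡s w<u u<v)
    refute true j≡s (inj₁ (w<v , v<u)) =
      avoids _ (f6 _ _) (occurrence p321 true p<j j<q j≡s w<v v<u)
    refute true j≡s (inj₂ (inj₁ (v<u , u<w))) =
      avoids _ (f4 _ _) (occurrence p213 true p<j j<q j≡s v<u u<w)
    refute true j≡s (inj₂ (inj₂ (u<w , w<v))) =
      avoids _ (f2 _ _) (occurrence p132 true p<j j<q j≡s u<w w<v)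

  avoids⇔noBadTriple : (∀ σ → Forbidden σ → Avoids π σ) ⇔ NoBadTriple
  avoids⇔noBadTriple = mk⇔ avoids⇒noBadTriple (λ noBad σ → noBadTriple⇒avoids noBad)

  -- Prefixes of π

  inner⇒1<n : ∀ {i : Fin n} → Inner i → 1 < n
  inner⇒1<n (1≤i , i+1<n) = ≤-trans (s≤s 1≤i) (<⇒≤ i+1<n)

  prefixUpTo-split : ∀ {i x} → PrefixUpTo π i x → PrefixBefore π i x ⊎ ∣ π ∣at i ≡ x
  prefixUpTo-split {i} {x} (k , k≤i , e) with m≤n⇒m<n∨m≡n k≤i
  ... | inj₁ k<i = inj₁ (k , k<i , e)
  ... | inj₂ k≡i = inj₂ (subst (λ k → ∣ π ∣at k ≡ x) (toℕ-injective k≡i) e)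

  prefixUpTo-step : ∀ {i′ i} → toℕ i ≡ suc (toℕ i′) →
                    ∀ x → PrefixUpTo π i x ⇔ (PrefixUpTo π i′ x ⊎ ∣ π ∣at i ≡ x)
  prefixUpTo-step {i′} {i} i≡ x = mk⇔ split join
    where
    split : PrefixUpTo π i x → PrefixUpTo π i′ x ⊎ ∣ π ∣at i ≡ x
    split x∈ with prefixUpTo-split x∈
    ... | inj₁ (k , k<i , e) = inj₁ (k , ≤-pred (subst (suc (toℕ k) ≤_) i≡ k<i) , e)
    ... | inj₂ e = inj₂ e
    join : PrefixUpTo π i′ x ⊎ ∣ π ∣at i ≡ x → PrefixUpTo π i x
    join (inj₁ (k , k≤i′ , e)) = k , ≤-trans k≤i′ (subst (toℕ i′ ≤_) (sym i≡) (n≤1+n _)) , e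
    join (inj₂ e)              = i , ≤-refl , e

  prefixUpTo-first : ∀ {i} → toℕ i ≡ 0 → IsInterval (PrefixUpTo π i)
  prefixUpTo-first {i} i≡0 = ∣ π ∣at i , ∣ π ∣at i , ≤-refl , inj₁ (λ x → mk⇔ (bounds x) (member x))
    where
    bounds : ∀ x → PrefixUpTo π i x → InRange (val i) (val i) (toℕ x)
    bounds x (k , k≤i , refl) with toℕ-injective {i = k} {j = i} (trans (n≤0⇒n≡0 (subst (toℕ k ≤_) i≡0 k≤i)) (sym i≡0))
    ... | refl = ≤-refl , ≤-refl
    member : ∀ x → InRange (val i) (val i) (toℕ x) → PrefixUpTo π i x
    member x (i≤x , x≤i) = i , ≤-refl , toℕ-injective (≤-antisym i≤x x≤i)

  -- Signed arc permutations have no bad triple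

  arc⇒noBadTriple : IsSignedArc π → NoBadTriple
  arc⇒noBadTriple arc {p} {j} {q} p<j j<q = refute (sign π j) refl
    where
    inner : Inner j
    inner = ≤-trans (s≤s z≤n) p<j , ≤-trans (s≤s j<q) (toℕ<n q)
    S : Subset n
    S = PrefixUpTo π j
    interval : IsInterval S
    interval = proj₁ (arc j inner)
    v∈ : S (∣ π ∣at j)
    v∈ = j , ≤-refl , refl
    u∈ : S (∣ π ∣at p)
    u∈ = p , <⇒≤ p<j , refl
    w∉ : ¬ S (∣ π ∣at q)
    w∉ (k , k≤j , e) = <⇒≱ j<q (subst (λ k → toℕ k ≤ toℕ j) (val-injective (cong toℕ e)) k≤j)
    refute : (s : Bool) → sign π j ≡ s → ¬ BadTurn s (val p) (val j) (val q)
    refute false j≡s = interval-start interval xv x∉ v∈ u∈ w∉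
      where
      x : Fin n
      x = proj₁ (cycPred (∣ π ∣at j))
      xv : IsCycPred x (∣ π ∣at j)
      xv = proj₂ (cycPred (∣ π ∣at j))
      x∉ : ¬ S x
      x∉ x∈ with prefixUpTo-split x∈
      ... | inj₁ before = not-¬ (proj₁ (proj₂ (arc j inner)) x xv before) j≡s
      ... | inj₂ e = cycSucc-≢ (isCycPred⇒CycSucc xv) (inner⇒1<n inner) (cong toℕ (sym e))
    refute true j≡s = interval-end interval vx x∉ v∈ u∈ w∉
      where
      x : Fin n
      x = proj₁ (cycSucc (∣ π ∣at j))
      vx : IsCycPred (∣ π ∣at j) x
      vx = proj₂ (cycSucc (∣ π ∣at j))
      x∉ : ¬ S x
      x∉ x∈ with prefixUpTo-split x∈
      ... | inj₁ before = not-¬ j≡s (proj₂ (proj₂ (arc j inner)) x vx before)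
      ... | inj₂ e = cycSucc-≢ (isCycPred⇒CycSucc vx) (inner⇒1<n inner) (cong toℕ e)

  -- Permutations without bad triples are signed arc permutations

  -- Without bad triples, each value after the first is adjacent in Z_n to an
  -- earlier value: otherwise both of its neighbours come later, and the
  -- previous value, the current one and a neighbour form a bad triple.
  adjacent-to-prefix : NoBadTriple → ∀ {i′ i} → toℕ i ≡ suc (toℕ i′) →
                       Adjacent (PrefixUpTo π i′) (∣ π ∣at i)
  adjacent-to-prefix noBad {i′} {i} i≡ with cycPred (∣ π ∣at i) | cycSucc (∣ π ∣at i)
  ... | x , xv | y , vy with toℕ (position x) ≤? toℕ i′ | toℕ (position y) ≤? toℕ i′
  ... | yes x-early | _ = inj₁ (x , (position x , x-early , at-position x) , xv)
  ... | no _ | yes y-early = inj₂ (y , (position y , y-early , at-position y) , vy)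
  ... | no x-late | no y-late = ⊥-elim (refute (sign π i) refl)
    where
    1<n : 1 < n
    1<n = ≤-<-trans (s≤s z≤n) (subst (_< n) i≡ (toℕ<n i))
    i′<i : i′ Fin.< i
    i′<i = subst (toℕ i′ <_) (sym i≡) ≤-refl
    later : ∀ z → ¬ (toℕ (position z) ≤ toℕ i′) → z ≢ ∣ π ∣at i → i Fin.< position z
    later z late z≢v = ≤∧≢⇒< (subst (_≤ toℕ (position z)) (sym i≡) (≰⇒> late))
      (λ e → z≢v (trans (sym (at-position z)) (cong (∣ π ∣at_) (sym (toℕ-injective e)))))
    xv′ : CycSucc n (val (position x)) (val i)
    xv′ = subst (λ z → CycSucc n (toℕ z) (val i)) (sym (at-position x)) (isCycPred⇒CycSucc xv)
    vy′ : CycSucc n (val i) (val (position y))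
    vy′ = subst (λ z → CycSucc n (val i) (toℕ z)) (sym (at-position y)) (isCycPred⇒CycSucc vy)
    i<x : i Fin.< position x
    i<x = later x x-late (λ e → cycSucc-≢ (isCycPred⇒CycSucc xv) 1<n (cong toℕ e))
    i<y : i Fin.< position y
    i<y = later y y-late (λ e → cycSucc-≢ (isCycPred⇒CycSucc vy) 1<n (cong toℕ (sym e)))
    refute : (s : Bool) → sign π i ≡ s → ⊥
    refute false i≡s = noBad i′<i i<y (subst (λ s → BadTurn s _ _ _) (sym i≡s)
      (cycSucc-cyclicʳ vy′ (toℕ<n _) (val-≢ i′<i) (val-≢ (<-trans i′<i i<y))))
    refute true i≡s = noBad i′<i i<x (subst (λ s → BadTurn s _ _ _) (sym i≡s)
      (cycSucc-cyclic xv′ (toℕ<n _) (val-≢ (<-trans i′<i i<x)) (val-≢ i′<i)))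

  prefix-interval : NoBadTriple → ∀ k (i : Fin n) → toℕ i ≡ k → IsInterval (PrefixUpTo π i)
  prefix-interval noBad zero    i i≡0 = prefixUpTo-first i≡0
  prefix-interval noBad (suc k) i i≡  =
    interval-grow (∣ π ∣at i) (prefixUpTo-step i≡′) (prefix-interval noBad k i′ (toℕ-fromℕ< k<n))
      v∉ (adjacent-to-prefix noBad i≡′)
    where
    k<n : k < n
    k<n = <-trans (n<1+n k) (subst (_< n) i≡ (toℕ<n i))
    i′ : Fin n
    i′ = fromℕ< k<n
    i≡′ : toℕ i ≡ suc (toℕ i′)
    i≡′ = trans i≡ (cong suc (sym (toℕ-fromℕ< k<n)))
    v∉ : ¬ PrefixUpTo π i′ (∣ π ∣at i)
    v∉ (j , j≤i′ , e) = <⇒≱ (subst (toℕ i′ <_) (sym i≡′) ≤-refl)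
      (subst (λ j → toℕ j ≤ toℕ i′) (val-injective (cong toℕ e)) j≤i′)

  noBadTriple⇒arc : NoBadTriple → IsSignedArc π
  noBadTriple⇒arc noBad i inner = prefix-interval noBad (toℕ i) i refl , positive , negative
    where
    next : Fin n
    next = fromℕ< (proj₂ inner)
    i<next : i Fin.< next
    i<next = subst (toℕ i <_) (sym (toℕ-fromℕ< (proj₂ inner))) ≤-refl
    positive : ∀ x → IsCycPred x (∣ π ∣at i) → PrefixBefore π i x → sign π i ≡ true
    positive x xv (k , k<i , refl) = ¬-not λ i≡false → noBad k<i i<next
      (subst (λ s → BadTurn s _ _ _) (sym i≡false)
        (cycSucc-cyclic (isCycPred⇒CycSucc xv) (toℕ<n _)
          (≢-sym (val-≢ (<-trans k<i i<next))) (≢-sym (val-≢ i<next))))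
    negative : ∀ x → IsCycPred (∣ π ∣at i) x → PrefixBefore π i x → sign π i ≡ false
    negative x vx (k , k<i , refl) = ¬-not λ i≡true → noBad k<i i<next
      (subst (λ s → BadTurn s _ _ _) (sym i≡true)
        (cycSucc-cyclicʳ (isCycPred⇒CycSucc vx) (toℕ<n _)
          (≢-sym (val-≢ i<next)) (≢-sym (val-≢ (<-trans k<i i<next)))))

  arc⇔noBadTriple : IsSignedArc π ⇔ NoBadTriple
  arc⇔noBadTriple = mk⇔ arc⇒noBadTriple noBadTriple⇒arc

theorem4p5 : ∀ (n : ℕ) (π : SignedPerm n) →
    IsSignedArc π ⇔ (∀ (σ : SignedPerm 3) → Forbidden σ → Avoids π σ)
theorem4p5 n π = ⇔.trans (arc⇔noBadTriple π) (⇔.sym (avoids⇔noBadTriple π))
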